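{- Let $d\geq 2$ and $w\in\{1,\ldots,d\}^{\mathbb{N}}$. If for every pair of distinct letters $i,j\in\{1,\dots,d\}$ the projection $\pi_{i,j}(w)$ is $1$-balanced, then the $2$-binomial complexity of $w$ equals its subword complexity.
   Context: The projection $\pi_{\mathcal{B}}(w)$ of a (finite or infinite) word $w$ onto a subalphabet $\mathcal{B}$ is obtained by erasing all letters not in $\mathcal{B}$; $\pi_{i,j}=\pi_{\{i,j\}}$. A word is $1$-balanced if for any two equally long factors $u,v$ and any letter $a$, the numbers of occurrences of $a$ in $u$ and $v$ differ by at most $1$. For finite words $u,x$, $\binom{u}{x}$ is the number of occurrences of $x$ in $u$ as a scattered subword; $u,v$ are $k$-binomially equivalent if $\binom{u}{x}=\binom{v}{x}$ for all words $x$ of length at most $k$. The subword complexity $p_w(n)$ counts distinct factors of length $n$ of $w$, and the $k$-binomial complexity $b^k_w(n)$ counts $k$-binomial equivalence classes of length-$n$ factors of $w$. -}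

module Defs where

open import Data.Nat using (ℕ; zero; suc; _+_; _≤_; _∸_)
open import Data.Fin using (Fin)
open import Data.Fin.Properties using (_≟_)
open import Data.List using (List; []; _∷_; length; filter)
open import Data.Product using (Σ; ∃; _×_; _,_; proj₁)
open import Data.Sum using (_⊎_)
open import Relation.Nullary using (yes; no; ¬_)
open import Relation.Binary.PropositionalEquality using (_≡_)

Word : ℕ → Set
Word d = ℕ → Fin d

factor : ∀ {d} → Word d → (m n : ℕ) → List (Fin d)
factor w m zero = []
factor w m (suc n) = w m ∷ factor w (suc m) n

IsFactor : ∀ {d} → Word d → List (Fin d) → Set
IsFactor w u = ∃ λ m → factor w m (length u) ≡ u

proj : ∀ {d} → Fin d → Fin d → List (Fin d) → List (Fin d)
proj i j [] = []
proj i j (a ∷ u) with a ≟ i | a ≟ j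
... | no _ | no _ = proj i j u
... | _    | _    = a ∷ proj i j u

count : ∀ {d} → Fin d → List (Fin d) → ℕ
count a [] = 0
count a (b ∷ u) with b ≟ a
... | yes _ = suc (count a u)
... | no _  = count a u

Close : ℕ → ℕ → Set
Close m n = (m ∸ n ≤ 1) × (n ∸ m ≤ 1)

-- The factors of the (finite or infinite) word π_{i,j}(w) are exactly the
-- words π_{i,j}(v) for v a factor of w.
IsProjFactor : ∀ {d} → Word d → Fin d → Fin d → List (Fin d) → Set
IsProjFactor w i j u = ∃ λ m → ∃ λ n → proj i j (factor w m n) ≡ u

ProjBalanced : ∀ {d} → Word d → Fin d → Fin d → Set
ProjBalanced {d} w i j =
  ∀ (u v : List (Fin d)) → IsProjFactor w i j u → IsProjFactor w i j v →
  length u ≡ length v → ∀ (a : Fin d) → Close (count a u) (count a v)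

binom : ∀ {d} → List (Fin d) → List (Fin d) → ℕ
binom u [] = 1
binom [] (b ∷ x) = 0
binom (a ∷ u) (b ∷ x) with a ≟ b
... | yes _ = binom u x + binom u (b ∷ x)
... | no _  = binom u (b ∷ x)

BinomEq : ∀ {d} → ℕ → List (Fin d) → List (Fin d) → Set
BinomEq {d} k u v = ∀ (x : List (Fin d)) → length x ≤ k → binom u x ≡ binom v x

Factors : ∀ {d} → Word d → ℕ → Set
Factors {d} w n = Σ (List (Fin d)) λ u → IsFactor w u × (length u ≡ n)

-- A type A with an equivalence R has exactly k classes: there is a map
-- Fin k → A hitting every class exactly once.
HasClasses : (A : Set) → (A → A → Set) → ℕ → Set
HasClasses A R k =
  Σ (Fin k → A) λ f →
    (∀ p q → R (f p) (f q) → p ≡ q) × (∀ a → ∃ λ p → R (f p) a)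

SubwordComplexity : ∀ {d} → Word d → ℕ → ℕ → Set
SubwordComplexity w n k =
  HasClasses (Factors w n) (λ u v → proj₁ u ≡ proj₁ v) k

BinomialComplexity : ∀ {d} → ℕ → Word d → ℕ → ℕ → Set
BinomialComplexity k w n c =
  HasClasses (Factors w n) (λ u v → BinomEq k (proj₁ u) (proj₁ v)) c

-- Two distinct words u, v of equal length are separated by their projections onto some
-- pair of distinct letters a, b, and 2-binomial equivalence of u and v passes to these
-- projections. So it suffices to show that two distinct factors X, Y of equal length of the
-- balanced word π_{a,b}(w) are never 2-binomially equivalent. The prefix weight
-- Σ_{p prefix of X} |p|_a equals C(X,aa) + C(X,ab) + |X|_a. After the longest common prefix,
-- say X continues with a and Y with b; balance bounds every prefix count of a in the rest of Y
-- by one more than that in the rest of X, so the prefix weight of X is strictly larger.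
module Submission where

open import Defs
open import Data.Nat using (ℕ; zero; suc; _+_; _*_; _≤_; _<_; _∸_; _⊓_; z≤n; s≤s)
open import Data.Nat.Properties hiding (_≟_)
open import Data.Nat.Tactic.RingSolver using (solve-∀)
open import Algebra.Properties.CommutativeSemigroup +-commutativeSemigroup using (interchange)
open import Data.Fin using (Fin)
open import Data.Fin.Properties using (_≟_)
open import Data.List using (List; []; _∷_; [_]; length; take)
open import Data.List.Properties using (∷-injectiveˡ; ∷-injectiveʳ; length-take)
open import Data.List.Relation.Unary.All using (All; []; _∷_)
open import Data.Product using (∃; _×_; _,_; proj₁; proj₂)
open import Data.Sum using (_⊎_; inj₁; inj₂; [_,_]′)
open import Data.Empty using (⊥-elim)
open import Relation.Nullary using (¬_; yes; no)
open import Relation.Binary.PropositionalEquality hiding ([_])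
open import Function.Bundles using (_⇔_; mk⇔)

private variable
  d : ℕ
  a b c e : Fin d
  u v x X Y : List (Fin d)

sumBelow : ℕ → (ℕ → ℕ) → ℕ
sumBelow zero    f = 0
sumBelow (suc n) f = f 0 + sumBelow n (λ k → f (suc k))

sumBelow-cong : ∀ n {f g : ℕ → ℕ} → (∀ k → f k ≡ g k) → sumBelow n f ≡ sumBelow n g
sumBelow-cong zero    f≡g = refl
sumBelow-cong (suc n) f≡g = cong₂ _+_ (f≡g 0) (sumBelow-cong n (λ k → f≡g (suc k)))

sumBelow-mono-≤ : ∀ n {f g : ℕ → ℕ} → (∀ k → f k ≤ g k) → sumBelow n f ≤ sumBelow n g
sumBelow-mono-≤ zero    f≤g = z≤n
sumBelow-mono-≤ (suc n) f≤g = +-mono-≤ (f≤g 0) (sumBelow-mono-≤ n (λ k → f≤g (suc k)))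

sumBelow-const+ : ∀ n m (f : ℕ → ℕ) → sumBelow n (λ k → m + f k) ≡ n * m + sumBelow n f
sumBelow-const+ zero    m f = refl
sumBelow-const+ (suc n) m f =
  trans (cong (m + f 0 +_) (sumBelow-const+ n m (λ k → f (suc k))))
        (interchange m (f 0) (n * m) _)

OneOf : Fin d → Fin d → Fin d → Set
OneOf a b c = c ≡ a ⊎ c ≡ b

oneOf? : (a b c : Fin d) → OneOf a b c ⊎ (c ≢ a × c ≢ b)
oneOf? a b c with c ≟ a | c ≟ b
... | yes c≡a | _       = inj₁ (inj₁ c≡a)
... | no _    | yes c≡b = inj₁ (inj₂ c≡b)
... | no c≢a  | no c≢b  = inj₂ (c≢a , c≢b)

proj-∷-∈ : OneOf a b c → proj a b (c ∷ u) ≡ c ∷ proj a b u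
proj-∷-∈ {a = a} {b} {c} c∈ with c ≟ a | c ≟ b
... | yes _  | _      = refl
... | no _   | yes _  = refl
... | no c≢a | no c≢b = ⊥-elim ([ c≢a , c≢b ]′ c∈)

proj-∷-∉ : c ≢ a → c ≢ b → proj a b (c ∷ u) ≡ proj a b u
proj-∷-∉ {c = c} {a} {b} c≢a c≢b with c ≟ a | c ≟ b
... | yes c≡a | _       = ⊥-elim (c≢a c≡a)
... | no _    | yes c≡b = ⊥-elim (c≢b c≡b)
... | no _    | no _    = refl

proj-letters : ∀ u → All (OneOf a b) (proj a b u)
proj-letters [] = []
proj-letters {a = a} {b} (c ∷ u) with oneOf? a b c
... | inj₁ c∈          rewrite proj-∷-∈ {u = u} c∈        = c∈ ∷ proj-letters u
... | inj₂ (c≢a , c≢b) rewrite proj-∷-∉ {u = u} c≢a c≢b = proj-letters u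

proj-∷-cancel : proj a b (c ∷ u) ≡ proj a b (c ∷ v) → proj a b u ≡ proj a b v
proj-∷-cancel {a = a} {b} {c} eq with oneOf? a b c
... | inj₁ c∈ = ∷-injectiveʳ (trans (sym (proj-∷-∈ c∈)) (trans eq (proj-∷-∈ c∈)))
... | inj₂ (c≢a , c≢b) =
  trans (sym (proj-∷-∉ c≢a c≢b)) (trans eq (proj-∷-∉ c≢a c≢b))

proj-injective : length u ≡ length v → (∀ a b → a ≢ b → proj a b u ≡ proj a b v) → u ≡ v
proj-injective {u = []}    {[]}    _ _ = refl
proj-injective {u = c ∷ u} {e ∷ v} |u|≡|v| proj≡ with c ≟ e
... | no c≢e = ⊥-elim (c≢e (∷-injectiveˡ heads))
  where
  heads : c ∷ proj c e u ≡ e ∷ proj c e v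
  heads = trans (sym (proj-∷-∈ (inj₁ refl))) (trans (proj≡ c e c≢e) (proj-∷-∈ (inj₂ refl)))
... | yes refl = cong (c ∷_)
  (proj-injective (suc-injective |u|≡|v|) (λ a b a≢b → proj-∷-cancel {c = c} {u} {v} (proj≡ a b a≢b)))

count-∷-≡ : count a (a ∷ u) ≡ suc (count a u)
count-∷-≡ {a = a} with a ≟ a
... | yes _   = refl
... | no a≢a = ⊥-elim (a≢a refl)

count-∷-≢ : c ≢ a → count a (c ∷ u) ≡ count a u
count-∷-≢ {c = c} {a} c≢a with c ≟ a
... | yes c≡a = ⊥-elim (c≢a c≡a)
... | no _    = refl

count-∷ : count a (c ∷ u) ≡ count a [ c ] + count a u
count-∷ {a = a} {c} with c ≟ a
... | yes _ = refl
... | no _  = refl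

binom-∷-≡ : binom (c ∷ u) (c ∷ x) ≡ binom u x + binom u (c ∷ x)
binom-∷-≡ {c = c} with c ≟ c
... | yes _   = refl
... | no c≢c = ⊥-elim (c≢c refl)

binom-∷-≢ : c ≢ e → binom (c ∷ u) (e ∷ x) ≡ binom u (e ∷ x)
binom-∷-≢ {c = c} {e} c≢e with c ≟ e
... | yes c≡e = ⊥-elim (c≢e c≡e)
... | no _    = refl

binom-singleton : ∀ u → binom u [ a ] ≡ count a u
binom-singleton [] = refl
binom-singleton {a = a} (c ∷ u) with c ≟ a
... | yes _ = cong suc (binom-singleton u)
... | no _  = binom-singleton u

binom-proj : ∀ u → All (OneOf a b) x → binom (proj a b u) x ≡ binom u x
binom-proj u [] = refl
binom-proj [] (_ ∷ _) = refl
binom-proj {a = a} {b} {e ∷ x} (c ∷ u) (e∈ ∷ x∈) with oneOf? a b c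
... | inj₂ (c≢a , c≢b) =
  begin
    binom (proj a b (c ∷ u)) (e ∷ x) ≡⟨ cong (λ z → binom z (e ∷ x)) (proj-∷-∉ c≢a c≢b) ⟩
    binom (proj a b u) (e ∷ x)       ≡⟨ binom-proj u (e∈ ∷ x∈) ⟩
    binom u (e ∷ x)                  ≡⟨ binom-∷-≢ {c = c} {u = u} {x} (λ { refl → [ c≢a , c≢b ]′ e∈ }) ⟨
    binom (c ∷ u) (e ∷ x)            ∎
  where open ≡-Reasoning
... | inj₁ c∈ rewrite proj-∷-∈ {u = u} c∈ with c ≟ e
...   | yes _ = cong₂ _+_ (binom-proj u x∈) (binom-proj u (e∈ ∷ x∈))
...   | no _  = binom-proj u (e∈ ∷ x∈)

module _ {d} (w : Word d) (a b : Fin d) where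

  IsProjFactor-tail : IsProjFactor w a b (c ∷ X) → IsProjFactor w a b X
  IsProjFactor-tail (m , n , eq) = go m n eq
    where
    go : ∀ m n → proj a b (factor w m n) ≡ c ∷ X → IsProjFactor w a b X
    go m (suc n) eq with oneOf? a b (w m)
    ... | inj₁ r = suc m , n , ∷-injectiveʳ (trans (sym (proj-∷-∈ r)) eq)
    ... | inj₂ (p , q) = go (suc m) n (trans (sym (proj-∷-∉ p q)) eq)

  IsProjFactor-take : ∀ k → IsProjFactor w a b X → IsProjFactor w a b (take k X)
  IsProjFactor-take k (m , n , refl) = m , prefix k m n
    where
    prefix : ∀ k m n → ∃ λ n′ → proj a b (factor w m n′) ≡ take k (proj a b (factor w m n))
    prefix zero    m n       = 0 , refl
    prefix (suc k) m zero    = 0 , refl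
    prefix (suc k) m (suc n) with oneOf? a b (w m)
    ... | inj₁ r with prefix k (suc m) n
    ...   | n′ , eq = suc n′ , trans (proj-∷-∈ r)
                        (trans (cong (w m ∷_) eq) (cong (take (suc k)) (sym (proj-∷-∈ r))))
    prefix (suc k) m (suc n) | inj₂ (p , q) with prefix (suc k) (suc m) n
    ...   | n′ , eq = suc n′ , trans (proj-∷-∉ p q)
                        (trans eq (cong (take (suc k)) (sym (proj-∷-∉ p q))))

  ProjBalanced⇒prefix-count-≤ : ProjBalanced w a b →
    IsProjFactor w a b X → IsProjFactor w a b Y → length X ≡ length Y →
    ∀ k → count a (take k Y) ≤ suc (count a (take k X))
  ProjBalanced⇒prefix-count-≤ {X = X} {Y = Y} balanced fX fY |X|≡|Y| k =
    ≤-trans (m≤n+m∸n m n) (≤-trans (+-monoʳ-≤ n Y≲X) (≤-reflexive (+-comm n 1)))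
    where
    m = count a (take k Y)
    n = count a (take k X)
    |Xₖ|≡|Yₖ| : length (take k X) ≡ length (take k Y)
    |Xₖ|≡|Yₖ| = trans (length-take k X) (trans (cong (k ⊓_) |X|≡|Y|) (sym (length-take k Y)))
    Y≲X : m ∸ n ≤ 1
    Y≲X = proj₂ (balanced _ _ (IsProjFactor-take k fX) (IsProjFactor-take k fY) |Xₖ|≡|Yₖ| a)

prefixWeight : Fin d → List (Fin d) → ℕ
prefixWeight a X = sumBelow (suc (length X)) (λ k → count a (take k X))

prefixWeight-∷ : prefixWeight a (c ∷ X) ≡ suc (length X) * count a [ c ] + prefixWeight a X
prefixWeight-∷ {a = a} {c} {X} =
  trans (sumBelow-cong (suc (length X)) (λ k → count-∷ {a = a} {c} {take k X}))
        (sumBelow-const+ (suc (length X)) (count a [ c ]) (λ k → count a (take k X)))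

prefixWeight-∷-cancel : length X ≡ length Y →
  prefixWeight a (c ∷ X) ≡ prefixWeight a (c ∷ Y) → prefixWeight a X ≡ prefixWeight a Y
prefixWeight-∷-cancel {X = X} {Y} {a} {c} |X|≡|Y| eq =
  +-cancelˡ-≡ (suc (length X) * count a [ c ]) _ _
    (trans (sym (prefixWeight-∷ {a = a} {c} {X}))
      (trans eq (trans (prefixWeight-∷ {a = a} {c} {Y})
        (cong (λ n → suc n * count a [ c ] + prefixWeight a Y) (sym |X|≡|Y|)))))

module _ {d} {a b : Fin d} (a≢b : a ≢ b) where

  length≡count+count : All (OneOf a b) X → length X ≡ count a X + count b X
  length≡count+count [] = refl
  length≡count+count {X = _ ∷ X} (inj₁ refl ∷ X∈)
    rewrite count-∷-≡ {a = a} {u = X} | count-∷-≢ {u = X} a≢b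
    = cong suc (length≡count+count X∈)
  length≡count+count {X = _ ∷ X} (inj₂ refl ∷ X∈)
    rewrite count-∷-≢ {u = X} (≢-sym a≢b) | count-∷-≡ {a = b} {u = X}
    = trans (cong suc (length≡count+count X∈)) (sym (+-suc (count a X) (count b X)))

  prefixWeight≡binom : All (OneOf a b) X →
    prefixWeight a X ≡ binom X (a ∷ a ∷ []) + binom X (a ∷ b ∷ []) + count a X
  prefixWeight≡binom [] = refl
  prefixWeight≡binom {X = _ ∷ X} (inj₁ refl ∷ X∈) =
    begin
      prefixWeight a (a ∷ X)
        ≡⟨ prefixWeight-∷ {a = a} {a} {X} ⟩
      suc (length X) * count a [ a ] + prefixWeight a X
        ≡⟨ cong₂ (λ n m → suc n * m + prefixWeight a X) (length≡count+count X∈) (count-∷-≡ {a = a} {u = []}) ⟩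
      suc (A + B) * 1 + prefixWeight a X
        ≡⟨ cong (suc (A + B) * 1 +_) (prefixWeight≡binom X∈) ⟩
      suc (A + B) * 1 + (binom X (a ∷ a ∷ []) + binom X (a ∷ b ∷ []) + A)
        ≡⟨ rearrange A B _ _ ⟩
      (A + binom X (a ∷ a ∷ [])) + (B + binom X (a ∷ b ∷ [])) + suc A
        ≡⟨ cong₂ (λ p q → (p + binom X (a ∷ a ∷ [])) + (q + binom X (a ∷ b ∷ [])) + suc A) (binom-singleton {a = a} X) (binom-singleton {a = b} X) ⟨
      (binom X [ a ] + binom X (a ∷ a ∷ [])) + (binom X [ b ] + binom X (a ∷ b ∷ [])) + suc A
        ≡⟨ cong₂ (λ p q → p + q + suc A)
             (binom-∷-≡ {c = a} {X} {[ a ]}) (binom-∷-≡ {c = a} {X} {[ b ]}) ⟨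
      binom (a ∷ X) (a ∷ a ∷ []) + binom (a ∷ X) (a ∷ b ∷ []) + suc A
        ≡⟨ cong (binom (a ∷ X) (a ∷ a ∷ []) + binom (a ∷ X) (a ∷ b ∷ []) +_) (count-∷-≡ {a = a} {u = X}) ⟨
      binom (a ∷ X) (a ∷ a ∷ []) + binom (a ∷ X) (a ∷ b ∷ []) + count a (a ∷ X) ∎
    where
    open ≡-Reasoning
    A = count a X
    B = count b X
    rearrange : ∀ A B Baa Bab → suc (A + B) * 1 + (Baa + Bab + A) ≡ (A + Baa) + (B + Bab) + suc A
    rearrange = solve-∀
  prefixWeight≡binom {X = _ ∷ X} (inj₂ refl ∷ X∈)
    rewrite prefixWeight-∷ {a = a} {b} {X}
          | count-∷-≢ {u = []} (≢-sym a≢b) | count-∷-≢ {u = X} (≢-sym a≢b)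
          | binom-∷-≢ {u = X} {x = [ a ]} (≢-sym a≢b) | binom-∷-≢ {u = X} {x = [ b ]} (≢-sym a≢b)
          | *-zeroʳ (suc (length X))
    = prefixWeight≡binom X∈

  prefixWeight-< : length X ≡ length Y →
    (∀ k → count a (take k Y) ≤ suc (count a (take k X))) →
    prefixWeight a (b ∷ Y) < prefixWeight a (a ∷ X)
  prefixWeight-< {X} {Y} |X|≡|Y| Y≲X
    rewrite prefixWeight-∷ {a = a} {b} {Y} | prefixWeight-∷ {a = a} {a} {X}
          | count-∷-≢ {u = []} (≢-sym a≢b) | count-∷-≡ {a = a} {u = []}
          | *-zeroʳ (suc (length Y))
    = s≤s (begin
      sumBelow (length Y) (λ k → count a (take (suc k) Y))
        ≡⟨ cong (λ n → sumBelow n (λ k → count a (take (suc k) Y))) (sym |X|≡|Y|) ⟩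
      sumBelow (length X) (λ k → count a (take (suc k) Y))
        ≤⟨ sumBelow-mono-≤ (length X) (λ k → Y≲X (suc k)) ⟩
      sumBelow (length X) (λ k → 1 + count a (take (suc k) X))
        ≡⟨ sumBelow-const+ (length X) 1 _ ⟩
      length X * 1 + prefixWeight a X ∎)
    where open ≤-Reasoning

  module _ (w : Word d) (balanced : ProjBalanced w a b) where

    balanced-prefixWeight-< : IsProjFactor w a b (a ∷ X) → IsProjFactor w a b (b ∷ Y) →
      length X ≡ length Y → prefixWeight a (b ∷ Y) < prefixWeight a (a ∷ X)
    balanced-prefixWeight-< {X} {Y} faX fbY |X|≡|Y| =
      prefixWeight-< {X = X} {Y} |X|≡|Y|
        (ProjBalanced⇒prefix-count-≤ w a b balanced
          (IsProjFactor-tail w a b faX) (IsProjFactor-tail w a b fbY) |X|≡|Y|)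

    balanced-prefixWeight-injective :
      IsProjFactor w a b X → IsProjFactor w a b Y → All (OneOf a b) X → All (OneOf a b) Y →
      length X ≡ length Y → prefixWeight a X ≡ prefixWeight a Y → X ≡ Y
    balanced-prefixWeight-injective {[]} {[]} _ _ _ _ _ _ = refl
    balanced-prefixWeight-injective {c ∷ X} {e ∷ Y} fX fY (c∈ ∷ X∈) (e∈ ∷ Y∈) |cX|≡|eY| eq
      with c ≟ e
    ... | yes refl =
      cong (c ∷_) (balanced-prefixWeight-injective
        (IsProjFactor-tail w a b fX) (IsProjFactor-tail w a b fY) X∈ Y∈ |X|≡|Y|
        (prefixWeight-∷-cancel {X = X} {Y} {a} {c} |X|≡|Y| eq))
      where |X|≡|Y| = suc-injective |cX|≡|eY|
    ... | no c≢e = heads c∈ e∈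
      where
      |X|≡|Y| = suc-injective |cX|≡|eY|
      heads : OneOf a b c → OneOf a b e → c ∷ X ≡ e ∷ Y
      heads (inj₁ refl) (inj₁ refl) = ⊥-elim (c≢e refl)
      heads (inj₂ refl) (inj₂ refl) = ⊥-elim (c≢e refl)
      heads (inj₁ refl) (inj₂ refl) =
        ⊥-elim (<-irrefl (sym eq) (balanced-prefixWeight-< fX fY |X|≡|Y|))
      heads (inj₂ refl) (inj₁ refl) =
        ⊥-elim (<-irrefl eq (balanced-prefixWeight-< fY fX (sym |X|≡|Y|)))

    balanced-binomEq₂⇒≡ :
      IsProjFactor w a b X → IsProjFactor w a b Y → All (OneOf a b) X → All (OneOf a b) Y →
      (∀ x → All (OneOf a b) x → length x ≤ 2 → binom X x ≡ binom Y x) → X ≡ Y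
    balanced-binomEq₂⇒≡ {X} {Y} fX fY X∈ Y∈ binom≡ =
      balanced-prefixWeight-injective fX fY X∈ Y∈ |X|≡|Y| prefixWeight≡
      where
      count≡ : ∀ c → OneOf a b c → count c X ≡ count c Y
      count≡ c c∈ = trans (sym (binom-singleton X))
        (trans (binom≡ [ c ] (c∈ ∷ []) (s≤s z≤n)) (binom-singleton Y))
      |X|≡|Y| : length X ≡ length Y
      |X|≡|Y| = trans (length≡count+count X∈)
        (trans (cong₂ _+_ (count≡ a (inj₁ refl)) (count≡ b (inj₂ refl)))
               (sym (length≡count+count Y∈)))
      prefixWeight≡ : prefixWeight a X ≡ prefixWeight a Y
      prefixWeight≡ = trans (prefixWeight≡binom X∈)
        (trans (cong₂ _+_
                 (cong₂ _+_ (binom≡ _ (inj₁ refl ∷ inj₁ refl ∷ []) (s≤s (s≤s z≤n)))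
                            (binom≡ _ (inj₁ refl ∷ inj₂ refl ∷ []) (s≤s (s≤s z≤n))))
                 (count≡ a (inj₁ refl)))
               (sym (prefixWeight≡binom Y∈)))

binomEq₂⇒≡ : (w : Word d) → (∀ (a b : Fin d) → a ≢ b → ProjBalanced w a b) →
  IsFactor w u → IsFactor w v → length u ≡ length v → BinomEq 2 u v → u ≡ v
binomEq₂⇒≡ {u = u} {v} w balanced (m , fu) (m′ , fv) |u|≡|v| binom≡ =
  proj-injective |u|≡|v| λ a b a≢b →
    balanced-binomEq₂⇒≡ a≢b w (balanced a b a≢b)
      (m , length u , cong (proj a b) fu) (m′ , length v , cong (proj a b) fv)
      (proj-letters u) (proj-letters v)
      (λ x x∈ |x|≤2 → trans (binom-proj u x∈) (trans (binom≡ x |x|≤2) (sym (binom-proj v x∈))))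

HasClasses-resp : ∀ {A : Set} {R S : A → A → Set} {k} → (∀ x y → R x y → S x y) →
  (∀ x y → S x y → R x y) → HasClasses A R k → HasClasses A S k
HasClasses-resp R⇒S S⇒R (f , injective , surjective) =
  f , (λ p q s → injective p q (S⇒R _ _ s)) ,
      (λ x → proj₁ (surjective x) , R⇒S _ _ (proj₂ (surjective x)))

lemma1 : (d : ℕ) → 2 ≤ d → (w : Word d) →
    (∀ (i j : Fin d) → ¬ (i ≡ j) → ProjBalanced w i j) →
    ∀ (n c : ℕ) → SubwordComplexity w n c ⇔ BinomialComplexity 2 w n c
lemma1 d _ w balanced n c =
  mk⇔ (HasClasses-resp ≡⇒binomEq binomEq⇒≡) (HasClasses-resp binomEq⇒≡ ≡⇒binomEq)
  where
  ≡⇒binomEq : ∀ (u v : Factors w n) → proj₁ u ≡ proj₁ v → BinomEq 2 (proj₁ u) (proj₁ v)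
  ≡⇒binomEq _ _ refl _ _ = refl
  binomEq⇒≡ : ∀ (u v : Factors w n) → BinomEq 2 (proj₁ u) (proj₁ v) → proj₁ u ≡ proj₁ v
  binomEq⇒≡ (_ , fu , |u|≡n) (_ , fv , |v|≡n) =
    binomEq₂⇒≡ w balanced fu fv (trans |u|≡n (sym |v|≡n))
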